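{- Let $B_n\subseteq\{0,1\}^n$ and $S_n := \{k\in[n]\mid \{k\}\text{ is a part of }\mathbf{SP}(B_n)\}$. There exists a subset $A_n \subseteq B_n$ of size $|A_n| \leq \frac{|S_n|}{2}$ such that, writing $\mathcal{Q}_{A_n} := \{\bigcap_{a\in A_n}\mathbf{SP}(a)(k)\mid k\in[n]\}$, for each part $P \in \mathcal{Q}_{A_n}$ one of the following two statements is true: 1. $|P \cap S_n| \leq 2$; or 2. $|P \cap S_n| > 2$ and for every $b \in B_n \setminus A_n$, one of these two conditions holds: $b$ is constant on $P \cap S_n$; or $b[P \cap S_n]$ is imbalanced and, for every $P' \in \mathcal{Q}_{A_n}$ with $P' \neq P$ and $|P' \cap S_n| > 2$, $b$ is constant on $P' \cap S_n$. Here $b[P \cap S_n]$ is the substring of $b$ at the positions in $P \cap S_n$; it is imbalanced if it contains exactly one $0$ and $1$s elsewhere, or exactly one $1$ and $0$s elsewhere; constant means only zeros or only ones at those positions.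
   Context: $\mathbf{Sym}_n$ acts on $\{0,1\}^n$ by permuting positions: $\pi(v) = v_{\pi^{ -1}(1)}\cdots v_{\pi^{ -1}(n)}$, and this extends to sets of strings. For $B\subseteq\{0,1\}^n$, $\mathbf{SP}(B)$ is the coarsest partition $\mathcal{P}$ of $[n]$ such that every $\pi\in\mathbf{Sym}_n$ fixing each part of $\mathcal{P}$ setwise stabilises $B$; for a string $a$, $\mathbf{SP}(a)$ is the partition into positions with $0$ and with $1$. $\mathcal{P}(k)$ is the part containing $k$. In the paper $B_n$ is the colour class $C$ of an ordered partition of $\{0,1\}^n$ maximising the number of parts of $\mathbf{SP}(C)$. -}

module Defs where

open import Data.Nat using (ℕ; _≤_; _<_; _*_)
open import Data.Bool using (Bool; true; false; not; _∧_)
open import Data.Bool.Properties using () renaming (_≟_ to _≟ᵇ_)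
open import Data.Fin using (Fin)
open import Data.Fin.Properties using (all?; _≟_)
open import Data.Fin.Subset using (Subset; _∈_; _∩_; ⊤)
open import Data.Fin.Permutation using (Permutation′; _⟨$⟩ʳ_; _⟨$⟩ˡ_)
open import Data.Vec using (Vec; lookup; tabulate)
open import Data.List using (List; foldr; map)
open import Data.Product using (Σ; _×_; ∃)
open import Data.Sum using (_⊎_)
open import Relation.Binary.PropositionalEquality using (_≡_; _≢_)
open import Relation.Nullary using (¬_; does)
open import Relation.Nullary.Decidable using (_→-dec_)
open import Function.Bundles using (_⇔_)

Str : ℕ → Set
Str n = Vec Bool n

StrSet : ℕ → Set
StrSet n = Str n → Bool

_∈B_ : ∀ {n} → Str n → StrSet n → Set
v ∈B B = B v ≡ true

act : ∀ {n} → Permutation′ n → Str n → Str n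
act π v = tabulate (λ i → lookup v (π ⟨$⟩ˡ i))

Stabilises : ∀ {n} → Permutation′ n → StrSet n → Set
Stabilises π B = ∀ v → (v ∈B B) ⇔ (act π v ∈B B)

-- A partition of [n] is given by a labelling of positions; the parts are
-- the fibres (k, l in the same part iff same label).
Partition : ℕ → Set
Partition n = Fin n → ℕ

FixesParts : ∀ {n} → Permutation′ n → Partition n → Set
FixesParts π p = ∀ k → p (π ⟨$⟩ʳ k) ≡ p k

Good : ∀ {n} → StrSet n → Partition n → Set
Good B p = ∀ (π : Permutation′ _) → FixesParts π p → Stabilises π B

Refines : ∀ {n} → Partition n → Partition n → Set
Refines q p = ∀ k l → q k ≡ q l → p k ≡ p l

IsSP : ∀ {n} → StrSet n → Partition n → Set
IsSP B p = Good B p × (∀ q → Good B q → Refines q p)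

SingletonPart? : ∀ {n} → Partition n → Fin n → Bool
SingletonPart? p k = does (all? (λ l → (p l Data.Nat.≟ p k) →-dec (l ≟ k)))

Sset : ∀ {n} → Partition n → Subset n
Sset p = tabulate (SingletonPart? p)

SPa : ∀ {n} → Str n → Fin n → Subset n
SPa a k = tabulate (λ l → does (lookup a l ≟ᵇ lookup a k))

Qpart : ∀ {n} → List (Str n) → Fin n → Subset n
Qpart A k = foldr _∩_ ⊤ (map (λ a → SPa a k) A)

Constant : ∀ {n} → Str n → Subset n → Set
Constant b X = (∀ l → l ∈ X → lookup b l ≡ false) ⊎ (∀ l → l ∈ X → lookup b l ≡ true)

Imbalanced : ∀ {n} → Str n → Subset n → Set
Imbalanced b X = Σ Bool λ c → ∃ λ l →
  l ∈ X × lookup b l ≡ c × (∀ l′ → l′ ∈ X → l′ ≢ l → lookup b l′ ≡ not c)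

{-# OPTIONS --safe #-}

-- Greedy. Call s ∈ S crowded for A when two smaller elements of S lie in its part of 𝒬_A;
-- adding strings to A only refines 𝒬_A, so it never crowds an uncrowded element. If some
-- b ∈ B ∖ A violates the conclusion at a part P with |P ∩ S| > 2, then adding b to A uncrowds
-- two elements of S. Either b takes each value twice on P ∩ S, and the largest two of the first
-- two zeros and first two ones are freed; or b is non-constant on P ∩ S and on another large
-- part P′ ∩ S, and in each of them the largest of the first two occurrences of a repeated value
-- and the first occurrence of the other value is freed. As at most |S| elements are uncrowded,
-- at most |S|/2 strings are added.
module Submission where

open import Defs
open import Data.Nat using (ℕ; _≤_; _<_; _*_)
open import Data.Fin using (Fin)
open import Data.Fin.Subset using (Subset; _∩_; ∣_∣)
open import Data.List using (List; length)
open import Data.List.Relation.Unary.All using (All)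
open import Data.List.Relation.Unary.Unique.Propositional using (Unique)
open import Data.List.Membership.Propositional using (_∉_)
open import Data.Product using (Σ; _×_)
open import Data.Sum using (_⊎_)
open import Relation.Binary.PropositionalEquality using (_≢_)

open import Data.Nat using (zero; suc; _+_; z≤n; s≤s)
open import Data.Nat.Properties
  using (_≤?_; _<?_; ≤-trans; ≤-reflexive; n≤1+n; n<1+n; +-monoʳ-≤; +-suc; *-suc; +-identityʳ; m≤m+n; <⇒≱; ≰⇒>)
open import Data.Bool using (Bool; true; false; not)
open import Data.Bool.Properties using (¬-not; not-¬) renaming (_≟_ to _≟ᵇ_)
open import Data.Fin using (zero; suc) renaming (_<_ to _<ᶠ_)
open import Data.Fin.Properties using (<-cmp; <-trans; <⇒≢; any?) renaming (_≟_ to _≟ᶠ_)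
open import Data.Fin.Subset using (_∈_; _∪_; _-_; ⁅_⁆; _⊆_)
open import Data.Fin.Subset.Properties
  using (_∈?_; x∈p∩q⁺; x∈p∩q⁻; x∈p∪q⁺; x∈⁅x⁆; p⊆q⇒∣p∣≤∣q∣; ∣⁅x⁆∣≡1; x∈p∧x≢y⇒x∈p-y; x∈p⇒∣p-x∣<∣p∣)
open import Data.Vec using (Vec; []; _∷_; lookup; tabulate)
open import Data.Vec.Properties using (lookup∘tabulate; []=⇒lookup; ≡-dec)
open import Data.List using ([]; _∷_)
open import Data.List.Relation.Unary.All as All using ([]; _∷_)
open import Data.List.Relation.Unary.All.Properties using (¬Any⇒All¬)
open import Data.List.Relation.Unary.AllPairs using ([]; _∷_)
import Data.List.Relation.Unary.Any as Any
open import Data.Product as Product using (∃; ∃₂; _,_; proj₁; proj₂)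
open import Data.Sum as Sum using (inj₁; inj₂)
open import Data.Empty using (⊥-elim)
open import Function using (_∘_; id)
open import Relation.Binary.Definitions using (tri<; tri≈; tri>)
open import Relation.Binary.PropositionalEquality using (_≡_; refl; sym; trans; cong; cong₂; subst)
open import Relation.Nullary using (¬_; yes; no; does; ¬?; _×-dec_)
open import Relation.Unary using (Decidable)

∀⊎∃-Fin : ∀ {n} {P Q : Fin n → Set} → (∀ i → P i ⊎ Q i) → (∀ i → P i) ⊎ ∃ Q
∀⊎∃-Fin {zero}  P⊎Q = inj₁ λ ()
∀⊎∃-Fin {suc _} P⊎Q with P⊎Q zero | ∀⊎∃-Fin (P⊎Q ∘ suc)
... | inj₂ q₀ | _            = inj₂ (zero , q₀)
... | inj₁ _  | inj₂ (i , q) = inj₂ (suc i , q)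
... | inj₁ p₀ | inj₁ ps      = inj₁ λ { zero → p₀ ; (suc i) → ps i }

∀⊎∃-Vec : ∀ {n} {P Q : Vec Bool n → Set} → (∀ v → P v ⊎ Q v) → (∀ v → P v) ⊎ ∃ Q
∀⊎∃-Vec {zero} P⊎Q with P⊎Q []
... | inj₁ p = inj₁ λ { [] → p }
... | inj₂ q = inj₂ ([] , q)
∀⊎∃-Vec {suc _} P⊎Q with ∀⊎∃-Vec (P⊎Q ∘ (true ∷_)) | ∀⊎∃-Vec (P⊎Q ∘ (false ∷_))
... | inj₂ (v , q) | _            = inj₂ (true ∷ v , q)
... | inj₁ _       | inj₂ (v , q) = inj₂ (false ∷ v , q)
... | inj₁ ps      | inj₁ qs      = inj₁ λ { (true ∷ v) → ps v ; (false ∷ v) → qs v }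

module _ {n : ℕ} where

  NoneBelow : (Fin n → Set) → Fin n → Set
  NoneBelow P s = ∀ {t} → P t → ¬ t <ᶠ s

  AtMostOneBelow : (Fin n → Set) → Fin n → Set
  AtMostOneBelow P s = ∃ λ c → ∀ {t} → P t → t <ᶠ s → t ≡ c

  TwoBelow : (Fin n → Set) → Fin n → Set
  TwoBelow P s = ∃₂ λ t t′ → t ≢ t′ × P t × P t′ × t <ᶠ s × t′ <ᶠ s

  Twice : (Fin n → Set) → Set
  Twice P = ∃₂ λ t t′ → t ≢ t′ × P t × P t′

  noneBelow⇒atMostOneBelow : ∀ {P s} → NoneBelow P s → AtMostOneBelow P s
  noneBelow⇒atMostOneBelow {s = s} none = s , λ pt t<s → ⊥-elim (none pt t<s)

  atMostOneBelow⇒¬twoBelow : ∀ {P s} → AtMostOneBelow P s → ¬ TwoBelow P s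
  atMostOneBelow⇒¬twoBelow (c , only) (t , t′ , t≢t′ , pt , pt′ , t<s , t′<s) =
    t≢t′ (trans (only pt t<s) (sym (only pt′ t′<s)))

  twoBelow-mono : ∀ {P Q : Fin n → Set} {s} → (∀ {t} → P t → Q t) → TwoBelow P s → TwoBelow Q s
  twoBelow-mono P⇒Q (t , t′ , t≢t′ , pt , pt′ , t<s , t′<s) = t , t′ , t≢t′ , P⇒Q pt , P⇒Q pt′ , t<s , t′<s

least : ∀ {n} {P : Fin n → Set} → Decidable P → ∀ {x} → P x → ∃ λ m → P m × NoneBelow P m
least P? {zero}  px = zero , px , λ _ ()
least P? {suc x} px with P? zero
... | yes p₀ = zero , p₀ , λ _ ()
... | no ¬p₀ with least (P? ∘ suc) px
...   | m , pm , none = suc m , pm , λ { {zero} p₀ _ → ¬p₀ p₀ ; {suc t} pt (s≤s t<m) → none pt t<m }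

record FirstTwo {n : ℕ} (P : Fin n → Set) : Set where
  field
    fst snd : Fin n
    fst<snd : fst <ᶠ snd
    P-fst : P fst
    P-snd : P snd
    fst-alone : AtMostOneBelow P fst
    snd-alone : AtMostOneBelow P snd

firstTwo : ∀ {n} {P : Fin n → Set} → Decidable P → Twice P → FirstTwo P
firstTwo {P = P} P? (x , y , x≢y , px , py)
  with least P? px
... | c , pc , c-least with least (λ t → P? t ×-dec ¬? (t ≟ᶠ c)) (proj₂ other)
  where
  other : ∃ λ w → P w × w ≢ c
  other with x ≟ᶠ c
  ... | yes refl = y , py , x≢y ∘ sym
  ... | no x≢c   = x , px , x≢c
... | c′ , (pc′ , c′≢c) , c′-least = record
  { fst = c ; snd = c′ ; fst<snd = c<c′ ; P-fst = pc ; P-snd = pc′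
  ; fst-alone = noneBelow⇒atMostOneBelow c-least
  ; snd-alone = c , only-c
  }
  where
  c<c′ : c <ᶠ c′
  c<c′ with <-cmp c c′
  ... | tri< lt _ _ = lt
  ... | tri≈ _ eq _ = ⊥-elim (c′≢c (sym eq))
  ... | tri> _ _ gt = ⊥-elim (c-least pc′ gt)
  only-c : ∀ {t} → P t → t <ᶠ c′ → t ≡ c
  only-c {t} pt t<c′ with t ≟ᶠ c
  ... | yes t≡c = t≡c
  ... | no t≢c  = ⊥-elim (c′-least (pt , t≢c) t<c′)

topOfThree : ∀ {n} {U : Fin n → Set} {p q r} → p ≢ q → p ≢ r → q ≢ r → U p → U q → U r →
             ∃ λ m → U m × TwoBelow U m
topOfThree {p = p} {q} {r} p≢q p≢r q≢r up uq ur with <-cmp p q | <-cmp p r | <-cmp q r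
... | tri≈ _ p≡q _ | _ | _ = ⊥-elim (p≢q p≡q)
... | _ | tri≈ _ p≡r _ | _ = ⊥-elim (p≢r p≡r)
... | _ | _ | tri≈ _ q≡r _ = ⊥-elim (q≢r q≡r)
... | tri< p<q _ _ | _ | tri< q<r _ _ = r , ur , p , q , p≢q , up , uq , <-trans p<q q<r , q<r
... | tri< p<q _ _ | _ | tri> _ _ r<q = q , uq , p , r , p≢r , up , ur , p<q , r<q
... | tri> _ _ q<p | tri< p<r _ _ | _ = r , ur , p , q , p≢q , up , uq , p<r , <-trans q<p p<r
... | tri> _ _ q<p | tri> _ _ r<p | _ = p , up , q , r , q≢r , uq , ur , q<p , r<p

∣p∪q∣≤∣p∣+∣q∣ : ∀ {n} (p q : Subset n) → ∣ p ∪ q ∣ ≤ ∣ p ∣ + ∣ q ∣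
∣p∪q∣≤∣p∣+∣q∣ []          []          = z≤n
∣p∪q∣≤∣p∣+∣q∣ (true ∷ p)  (true ∷ q)  = s≤s (≤-trans (∣p∪q∣≤∣p∣+∣q∣ p q) (+-monoʳ-≤ ∣ p ∣ (n≤1+n ∣ q ∣)))
∣p∪q∣≤∣p∣+∣q∣ (true ∷ p)  (false ∷ q) = s≤s (∣p∪q∣≤∣p∣+∣q∣ p q)
∣p∪q∣≤∣p∣+∣q∣ (false ∷ p) (true ∷ q)  =
  ≤-trans (s≤s (∣p∪q∣≤∣p∣+∣q∣ p q)) (≤-reflexive (sym (+-suc ∣ p ∣ ∣ q ∣)))
∣p∪q∣≤∣p∣+∣q∣ (false ∷ p) (false ∷ q) = ∣p∪q∣≤∣p∣+∣q∣ p q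

2<∣p∣⇒∃-other : ∀ {n} {p : Subset n} → 2 < ∣ p ∣ → ∀ u v → ∃ λ w → w ∈ p × w ≢ u × w ≢ v
2<∣p∣⇒∃-other {p = p} 2<∣p∣ u v with any? (λ w → (w ∈? p) ×-dec ¬? (w ≟ᶠ u) ×-dec ¬? (w ≟ᶠ v))
... | yes other = other
... | no none = ⊥-elim (<⇒≱ 2<∣p∣ (∣p∣≤2))
  where
  p⊆uv : p ⊆ ⁅ u ⁆ ∪ ⁅ v ⁆
  p⊆uv {w} w∈p with w ≟ᶠ u | w ≟ᶠ v
  ... | yes refl | _        = x∈p∪q⁺ (inj₁ (x∈⁅x⁆ w))
  ... | no _     | yes refl = x∈p∪q⁺ (inj₂ (x∈⁅x⁆ w))
  ... | no w≢u   | no w≢v   = ⊥-elim (none (w , w∈p , w≢u , w≢v))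
  ∣p∣≤2 : ∣ p ∣ ≤ 2
  ∣p∣≤2 = ≤-trans (p⊆q⇒∣p∣≤∣q∣ p⊆uv)
            (≤-trans (∣p∪q∣≤∣p∣+∣q∣ ⁅ u ⁆ ⁅ v ⁆) (≤-reflexive (cong₂ _+_ (∣⁅x⁆∣≡1 u) (∣⁅x⁆∣≡1 v))))

unique⇒length≤∣p∣ : ∀ {n} {p : Subset n} {xs : List (Fin n)} → Unique xs → All (_∈ p) xs → length xs ≤ ∣ p ∣
unique⇒length≤∣p∣ []                []           = z≤n
unique⇒length≤∣p∣ {p = p} {x ∷ xs} (x∉xs ∷ unique) (x∈p ∷ xs⊆p) =
  ≤-trans (s≤s (unique⇒length≤∣p∣ unique xs⊆p-x)) (x∈p⇒∣p-x∣<∣p∣ x∈p)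
  where
  xs⊆p-x : All (_∈ p - x) xs
  xs⊆p-x = All.zipWith (λ (y∈p , x≢y) → x∈p∧x≢y⇒x∈p-y y∈p (x≢y ∘ sym)) (xs⊆p , x∉xs)

∈SPa⁻ : ∀ {n} (a : Str n) {k l} → l ∈ SPa a k → lookup a l ≡ lookup a k
∈SPa⁻ a {k} {l} l∈ with lookup a l ≟ᵇ lookup a k | trans (sym (lookup∘tabulate _ l)) ([]=⇒lookup l∈)
... | yes eq | _ = eq
... | no _   | ()

Qpart-≡ : ∀ {n} (A : List (Str n)) {k s} → s ∈ Qpart A k → Qpart A s ≡ Qpart A k
Qpart-≡ []      _  = refl
Qpart-≡ (a ∷ A) s∈ with x∈p∩q⁻ (SPa a _) _ s∈
... | s∈a , s∈A =
  cong₂ _∩_ (cong (λ x → tabulate (λ l → does (lookup a l ≟ᵇ x))) (∈SPa⁻ a s∈a)) (Qpart-≡ A s∈A)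

module _ {n : ℕ} (b : Str n) where

  Coloured : Bool → Subset n → Fin n → Set
  Coloured β X t = t ∈ X × lookup b t ≡ β

  coloured? : ∀ β X → Decidable (Coloured β X)
  coloured? β X t = (t ∈? X) ×-dec (lookup b t ≟ᵇ β)

  Bicoloured : Subset n → Set
  Bicoloured X = ∃ (Coloured false X) × ∃ (Coloured true X)

  TwiceEach : Subset n → Set
  TwiceEach X = Twice (Coloured false X) × Twice (Coloured true X)

  colours-≢ : ∀ {x y β γ} → β ≢ γ → lookup b x ≡ β → lookup b y ≡ γ → x ≢ y
  colours-≢ β≢γ bx by refl = β≢γ (trans (sym bx) by)

  constant⊎bicoloured : ∀ X → Constant b X ⊎ Bicoloured X
  constant⊎bicoloured X with any? (coloured? true X) | any? (coloured? false X)
  ... | no no-true | _           = inj₁ (inj₁ λ l l∈X → ¬-not λ bl → no-true (l , l∈X , bl))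
  ... | _          | no no-false = inj₁ (inj₂ λ l l∈X → ¬-not λ bl → no-false (l , l∈X , bl))
  ... | yes some-true | yes some-false = inj₂ (some-false , some-true)

  sole⊎twice : ∀ β X {x} → Coloured β X x →
               (∀ l → l ∈ X → l ≢ x → lookup b l ≡ not β) ⊎ Twice (Coloured β X)
  sole⊎twice β X {x} cx with any? (λ t → coloured? β X t ×-dec ¬? (t ≟ᶠ x))
  ... | yes (t , ct , t≢x) = inj₂ (x , t , t≢x ∘ sym , cx , ct)
  ... | no none            = inj₁ λ l l∈X l≢x → ¬-not λ bl → none (l , (l∈X , bl) , l≢x)

  imbalanced⊎twiceEach : ∀ X → Bicoloured X → Imbalanced b X ⊎ TwiceEach X
  imbalanced⊎twiceEach X ((x₀ , c₀) , (x₁ , c₁)) with sole⊎twice false X c₀ | sole⊎twice true X c₁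
  ... | inj₁ rest₀ | _          = inj₁ (false , x₀ , proj₁ c₀ , proj₂ c₀ , rest₀)
  ... | _          | inj₁ rest₁ = inj₁ (true , x₁ , proj₁ c₁ , proj₂ c₁ , rest₁)
  ... | inj₂ two₀  | inj₂ two₁  = inj₂ (two₀ , two₁)

module Parts {n : ℕ} (S : Subset n) where

  Part : List (Str n) → Fin n → Subset n
  Part A k = Qpart A k ∩ S

  Part-≡ : ∀ A {k s} → s ∈ Part A k → Part A s ≡ Part A k
  Part-≡ A s∈ = cong (_∩ S) (Qpart-≡ A (proj₁ (x∈p∩q⁻ _ S s∈)))

  ∈Part-∷⁻ : ∀ A b {s t} → t ∈ Part (b ∷ A) s → t ∈ Part A s × lookup b t ≡ lookup b s
  ∈Part-∷⁻ A b t∈ with x∈p∩q⁻ _ S t∈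
  ... | t∈bA , t∈S with x∈p∩q⁻ (SPa b _) _ t∈bA
  ...   | t∈b , t∈A = x∈p∩q⁺ (t∈A , t∈S) , ∈SPa⁻ b t∈b

  Crowded : List (Str n) → Fin n → Set
  Crowded A s = TwoBelow (_∈ Part A s) s

  crowded-∷⁻ : ∀ A b {s} → Crowded (b ∷ A) s → Crowded A s
  crowded-∷⁻ A b = twoBelow-mono (proj₁ ∘ ∈Part-∷⁻ A b)

  Freed : List (Str n) → Str n → Fin n → Set
  Freed A b s = s ∈ S × Crowded A s × ¬ Crowded (b ∷ A) s

  Gain : List (Str n) → Str n → Set
  Gain A b = ∃₂ λ s s′ → s ≢ s′ × Freed A b s × Freed A b s′

  crowded-in-Part : ∀ A {k s} → s ∈ Part A k → TwoBelow (_∈ Part A k) s → Crowded A s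
  crowded-in-Part A s∈ = twoBelow-mono (subst (_ ∈_) (sym (Part-≡ A s∈)))

  Candidate : List (Str n) → Str n → Fin n → Fin n → Set
  Candidate A b k t = t ∈ Part A k × ¬ Crowded (b ∷ A) t

  candidate-of-alone : ∀ A b {k β s} → Coloured b β (Part A k) s →
                       AtMostOneBelow (Coloured b β (Part A k)) s → Candidate A b k s
  candidate-of-alone A b {k} {β} {s} (s∈ , bs) alone =
    s∈ , atMostOneBelow⇒¬twoBelow alone ∘ twoBelow-mono recolour
    where
    recolour : ∀ {t} → t ∈ Part (b ∷ A) s → Coloured b β (Part A k) t
    recolour t∈ with ∈Part-∷⁻ A b t∈
    ... | t∈A , bt = subst (_ ∈_) (Part-≡ A s∈) t∈A , trans bt bs

  freed-of-three : ∀ A b {k} {U : Fin n → Set} → (∀ {t} → U t → Candidate A b k t) →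
              ∀ {p q r} → p ≢ q → p ≢ r → q ≢ r → U p → U q → U r → ∃ λ m → U m × Freed A b m
  freed-of-three A b candidate p≢q p≢r q≢r up uq ur =
    let m , um , two = topOfThree p≢q p≢r q≢r up uq ur
        m∈ , uncrowded = candidate um
    in m , um , proj₂ (x∈p∩q⁻ _ S m∈)
     , crowded-in-Part A m∈ (twoBelow-mono (proj₁ ∘ candidate) two) , uncrowded

  freed-of-majority : ∀ A b {k} γ → Twice (Coloured b γ (Part A k)) → ∃ (Coloured b (not γ) (Part A k)) →
                      ∃ λ s → s ∈ Part A k × Freed A b s
  freed-of-majority A b {k} γ twice (_ , cx) =
    let f , cf , f-least = least (coloured? b (not γ) (Part A k)) cx
        ≢f : ∀ {t} → Coloured b γ (Part A k) t → t ≢ f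
        ≢f ct = colours-≢ b (not-¬ refl) (proj₂ ct) (proj₂ cf)
        s , (s∈ , _) , freed =
          freed-of-three A b id (<⇒≢ fst<snd) (≢f P-fst) (≢f P-snd)
            (candidate-of-alone A b P-fst fst-alone) (candidate-of-alone A b P-snd snd-alone)
            (candidate-of-alone A b cf (noneBelow⇒atMostOneBelow f-least))
    in s , s∈ , freed
    where open FirstTwo (firstTwo (coloured? b γ (Part A k)) twice)

  freed-of-bicoloured : ∀ A b {k} → 2 < ∣ Part A k ∣ → Bicoloured b (Part A k) →
                        ∃ λ s → s ∈ Part A k × Freed A b s
  freed-of-bicoloured A b large ((x₀ , c₀) , (x₁ , c₁)) with 2<∣p∣⇒∃-other large x₀ x₁
  ... | z , z∈ , z≢x₀ , z≢x₁ with lookup b z in bz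
  ...   | false = freed-of-majority A b false (z , x₀ , z≢x₀ , (z∈ , bz) , c₀) (x₁ , c₁)
  ...   | true  = freed-of-majority A b true  (z , x₁ , z≢x₁ , (z∈ , bz) , c₁) (x₀ , c₀)

  -- G.snd is crowded by F.fst and G.fst, and the largest of F.fst, F.snd, G.fst by the other two.
  gain-of-ordered : ∀ A b {k β γ} → β ≢ γ →
                    (F : FirstTwo (Coloured b β (Part A k))) (G : FirstTwo (Coloured b γ (Part A k))) →
                    FirstTwo.fst F <ᶠ FirstTwo.fst G → Gain A b
  gain-of-ordered A b {k} {β} {γ} β≢γ F G F<G =
    let s , (_ , s≢G) , freed =
          freed-of-three A b {U = λ t → Candidate A b k t × t ≢ G.snd} proj₁
            (<⇒≢ F.fst<snd) (F≢G F.P-fst G.P-fst) (F≢G F.P-snd G.P-fst)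
            (candidate-of-alone A b F.P-fst F.fst-alone , F≢G F.P-fst G.P-snd)
            (candidate-of-alone A b F.P-snd F.snd-alone , F≢G F.P-snd G.P-snd)
            (candidate-of-alone A b G.P-fst G.fst-alone , <⇒≢ G.fst<snd)
    in s , G.snd , s≢G , freed , freed-G
    where
    module F = FirstTwo F
    module G = FirstTwo G
    F≢G : ∀ {t t′} → Coloured b β (Part A k) t → Coloured b γ (Part A k) t′ → t ≢ t′
    F≢G ct ct′ = colours-≢ b β≢γ (proj₂ ct) (proj₂ ct′)
    freed-G : Freed A b G.snd
    freed-G = proj₂ (x∈p∩q⁻ _ S (proj₁ G.P-snd))
            , crowded-in-Part A (proj₁ G.P-snd)
                (F.fst , G.fst , F≢G F.P-fst G.P-fst , proj₁ F.P-fst , proj₁ G.P-fst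
                , <-trans F<G G.fst<snd , G.fst<snd)
            , proj₂ (candidate-of-alone A b G.P-snd G.snd-alone)

  gain-of-firstTwos : ∀ A b {k β γ} → β ≢ γ →
                      FirstTwo (Coloured b β (Part A k)) → FirstTwo (Coloured b γ (Part A k)) → Gain A b
  gain-of-firstTwos A b β≢γ F G with <-cmp (FirstTwo.fst F) (FirstTwo.fst G)
  ... | tri< F<G _ _ = gain-of-ordered A b β≢γ F G F<G
  ... | tri≈ _ F≡G _ = ⊥-elim (colours-≢ b β≢γ (proj₂ (FirstTwo.P-fst F)) (proj₂ (FirstTwo.P-fst G)) F≡G)
  ... | tri> _ _ G<F = gain-of-ordered A b (β≢γ ∘ sym) G F G<F

  gain-of-twiceEach : ∀ A b {k} → TwiceEach b (Part A k) → Gain A b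
  gain-of-twiceEach A b {k} (twice₀ , twice₁) =
    gain-of-firstTwos A b (λ ())
      (firstTwo (coloured? b false (Part A k)) twice₀) (firstTwo (coloured? b true (Part A k)) twice₁)

  gain-of-two-parts : ∀ A b {k k′} → Qpart A k′ ≢ Qpart A k →
                      ∃ (λ s → s ∈ Part A k × Freed A b s) → ∃ (λ s → s ∈ Part A k′ × Freed A b s) → Gain A b
  gain-of-two-parts A b k′≢k (s , s∈ , freed) (s′ , s′∈ , freed′) = s , s′ , s≢s′ , freed , freed′
    where
    s≢s′ : s ≢ s′
    s≢s′ refl = k′≢k (trans (sym (Qpart-≡ A (proj₁ (x∈p∩q⁻ _ S s′∈)))) (Qpart-≡ A (proj₁ (x∈p∩q⁻ _ S s∈))))

  ConstantOnOtherLargeParts : List (Str n) → Fin n → Str n → Set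
  ConstantOnOtherLargeParts A k b = ∀ k′ → Qpart A k′ ≢ Qpart A k → 2 < ∣ Part A k′ ∣ → Constant b (Part A k′)

  Settled : List (Str n) → Fin n → Str n → Set
  Settled A k b = Constant b (Part A k) ⊎ (Imbalanced b (Part A k) × ConstantOnOtherLargeParts A k b)

  constantOnOtherLargeParts⊎gain : ∀ A k b → 2 < ∣ Part A k ∣ → Bicoloured b (Part A k) →
                                   ConstantOnOtherLargeParts A k b ⊎ Gain A b
  constantOnOtherLargeParts⊎gain A k b large bicoloured = Sum.map₂ proj₂ (∀⊎∃-Fin constant⊎gain)
    where
    constant⊎gain : ∀ k′ → (Qpart A k′ ≢ Qpart A k → 2 < ∣ Part A k′ ∣ → Constant b (Part A k′)) ⊎ Gain A b
    constant⊎gain k′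
      with ≡-dec _≟ᵇ_ (Qpart A k′) (Qpart A k) | 2 <? ∣ Part A k′ ∣ | constant⊎bicoloured b (Part A k′)
    ... | yes same   | _           | _              = inj₁ λ differ _ → ⊥-elim (differ same)
    ... | _          | no small    | _              = inj₁ λ _ large′ → ⊥-elim (small large′)
    ... | _          | _           | inj₁ constant  = inj₁ λ _ _ → constant
    ... | no differ  | yes large′  | inj₂ bicoloured′ =
      inj₂ (gain-of-two-parts A b differ
              (freed-of-bicoloured A b large bicoloured) (freed-of-bicoloured A b large′ bicoloured′))

  settled⊎gain : ∀ A k b → 2 < ∣ Part A k ∣ → Settled A k b ⊎ Gain A b
  settled⊎gain A k b large with constant⊎bicoloured b (Part A k)
  ... | inj₁ constant = inj₁ (inj₁ constant)
  ... | inj₂ bicoloured with imbalanced⊎twiceEach b (Part A k) bicoloured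
  ...   | inj₂ twiceEach  = inj₂ (gain-of-twiceEach A b twiceEach)
  ...   | inj₁ imbalanced =
    Sum.map₁ (λ elsewhere → inj₂ (imbalanced , elsewhere))
      (constantOnOtherLargeParts⊎gain A k b large bicoloured)

module Greedy {n : ℕ} (S : Subset n) (B : StrSet n) where
  open Parts S

  Resolved : List (Str n) → Fin n → Set
  Resolved A k = ∣ Part A k ∣ ≤ 2 ⊎ (2 < ∣ Part A k ∣ × (∀ b → b ∈B B → b ∉ A → Settled A k b))

  resolved⊎gain : ∀ A k → Resolved A k ⊎ ∃ λ b → b ∈B B × b ∉ A × Gain A b
  resolved⊎gain A k with ∣ Part A k ∣ ≤? 2
  ... | yes small = inj₁ (inj₁ small)
  ... | no ¬small = Sum.map₁ (λ settled → inj₂ (large , settled)) (∀⊎∃-Vec settled⊎gain′)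
    where
    large : 2 < ∣ Part A k ∣
    large = ≰⇒> ¬small
    settled⊎gain′ : ∀ b → (b ∈B B → b ∉ A → Settled A k b) ⊎ (b ∈B B × b ∉ A × Gain A b)
    settled⊎gain′ b with B b ≟ᵇ true | Any.any? (≡-dec _≟ᵇ_ b) A
    ... | no b∉B  | _       = inj₁ λ b∈B _ → ⊥-elim (b∉B b∈B)
    ... | _       | yes b∈A = inj₁ λ _ b∉A → ⊥-elim (b∉A b∈A)
    ... | yes b∈B | no b∉A  =
      Sum.map (λ settled _ _ → settled) (λ gain → b∈B , b∉A , gain) (settled⊎gain A k b large)

  record Certificate (A : List (Str n)) : Set where
    field
      witnesses        : List (Fin n)
      unique           : Unique witnesses
      uncrowded        : All (λ s → s ∈ S × ¬ Crowded A s) witnesses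
      length-witnesses : length witnesses ≡ 2 * length A

  certificate-[] : Certificate []
  certificate-[] = record { witnesses = [] ; unique = [] ; uncrowded = [] ; length-witnesses = refl }

  certificate-bound : ∀ {A} → Certificate A → 2 * length A ≤ ∣ S ∣
  certificate-bound cert =
    ≤-trans (≤-reflexive (sym length-witnesses)) (unique⇒length≤∣p∣ unique (All.map proj₁ uncrowded))
    where open Certificate cert

  certificate-∷ : ∀ {A b} → Certificate A → Gain A b → Certificate (b ∷ A)
  certificate-∷ {A} {b} cert
    (s , s′ , s≢s′ , (s∈S , crowded , uncrowded-s) , (s′∈S , crowded′ , uncrowded-s′)) = record
    { witnesses        = s ∷ s′ ∷ witnesses
    ; unique           = (s≢s′ ∷ All.map (≢uncrowded crowded) uncrowded)
                         ∷ All.map (≢uncrowded crowded′) uncrowded ∷ unique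
    ; uncrowded        = (s∈S , uncrowded-s) ∷ (s′∈S , uncrowded-s′) ∷
                         All.map (Product.map₂ (λ ¬crowded → ¬crowded ∘ crowded-∷⁻ A b)) uncrowded
    ; length-witnesses = trans (cong (2 +_) length-witnesses) (sym (*-suc 2 (length A)))
    }
    where
    open Certificate cert
    ≢uncrowded : ∀ {x y} → Crowded A x → y ∈ S × ¬ Crowded A y → x ≢ y
    ≢uncrowded crowded-x (_ , uncrowded-y) refl = uncrowded-y crowded-x

  Solution : Set
  Solution = Σ (List (Str n)) λ A →
    Unique A × All (λ a → a ∈B B) A × 2 * length A ≤ ∣ S ∣ × (∀ k → Resolved A k)

  iterate : ∀ fuel A → Unique A → All (λ a → a ∈B B) A → Certificate A → ∣ S ∣ < length A + fuel → Solution
  iterate zero A _ _ cert enough =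
    ⊥-elim (<⇒≱ enough (≤-trans (≤-reflexive (+-identityʳ (length A)))
                                 (≤-trans (m≤m+n _ _) (certificate-bound cert))))
  iterate (suc fuel) A unique inB cert enough with ∀⊎∃-Fin (resolved⊎gain A)
  ... | inj₁ resolved = A , unique , inB , certificate-bound cert , resolved
  ... | inj₂ (_ , b , b∈B , b∉A , gain) =
    iterate fuel (b ∷ A) (¬Any⇒All¬ A b∉A ∷ unique) (b∈B ∷ inB) (certificate-∷ cert gain)
      (subst (∣ S ∣ <_) (+-suc (length A) fuel) enough)

lemma29 : (n : ℕ) (B : StrSet n) (𝒫 : Partition n) → IsSP B 𝒫 →
    Σ (List (Str n)) λ A →
      Unique A × All (λ a → a ∈B B) A × 2 * length A ≤ ∣ Sset 𝒫 ∣ ×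
      (∀ (k : Fin n) →
        ∣ Qpart A k ∩ Sset 𝒫 ∣ ≤ 2 ⊎
        (2 < ∣ Qpart A k ∩ Sset 𝒫 ∣ ×
          (∀ (b : Str n) → b ∈B B → b ∉ A →
            Constant b (Qpart A k ∩ Sset 𝒫) ⊎
            (Imbalanced b (Qpart A k ∩ Sset 𝒫) ×
              (∀ (k′ : Fin n) → Qpart A k′ ≢ Qpart A k →
                2 < ∣ Qpart A k′ ∩ Sset 𝒫 ∣ →
                Constant b (Qpart A k′ ∩ Sset 𝒫))))))
lemma29 n B 𝒫 _ = iterate (suc ∣ Sset 𝒫 ∣) [] [] [] certificate-[] (n<1+n ∣ Sset 𝒫 ∣)
  where open Greedy (Sset 𝒫) B
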